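{- For every positive integer $k$: (i) for every pattern $q\in S_k$ with $q\ne k(k-1)\cdots 1$, there is an even $n$ with $|A_n(k(k-1)\cdots1)|\ne|A_n(q)|$; (ii) the matrix $J_k$ is not shape-equivalent for $2$-alternating AD-Young diagrams to any permutation matrix other than $J_k$.
   Context: $A_n(q)$ is the set of alternating permutations ($w_1<w_2>w_3<\cdots$) of length $n$ avoiding the pattern $q$. $J_k=M(k(k-1)\cdots1)$, where $M(p)$ for $p=p_1\cdots p_r$ is the $r\times r$ matrix with $1$ in position $(i,p_i)$ and $0$ elsewhere. Young diagrams are in English notation with matrix coordinates: $Y=(Y_1\ge\cdots\ge Y_m)$ with $m$ rows consists of squares $(i,j)$, $1\le i\le m$, $1\le j\le Y_i$, with $Y_1=m$. An AD-Young diagram is $(Y,A,D)$ with $A,D$ disjoint subsets of $[m-1]$ such that rows $i,i+1$ have equal length whenever $i\in A\cup D$; it is $2$-alternating if for all integers $i$ with $0\le i\le m-2$: $i\in A$ iff $i+1\in D$. A transversal $T=\{(i,t_i)\}$ of $Y$ has one square of $Y$ in each row and column; it is valid if $t_i<t_{i+1}$ for $i\in A$ and $t_i>t_{i+1}$ for $i\in D$. $T$ contains an $r\times r$ permutation matrix $M$ if there are rows $a_1<\cdots<a_r$, columns $b_1<\cdots<b_r$ with $(a_r,b_r)\in Y$ and $(a_i,b_j)\in T$ iff $M_{ij}=1$; otherwise it avoids $M$. $S_{\mathcal{Y}}(M)$ is the set of valid transversals avoiding $M$. Matrices $M,N$ are shape-equivalent for $2$-alternating AD-Young diagrams if $|S_{\mathcal{Y}}(M)|=|S_{\mathcal{Y}}(N)|$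 for every $2$-alternating AD-Young diagram $\mathcal{Y}$. -}

module Defs where

open import Data.Nat.Base using (ℕ; zero; suc; _+_; _*_; _∸_; _≤_; _<_; _≡ᵇ_; _<ᵇ_; _≤ᵇ_)
open import Data.Bool.Base using (Bool; true; false; not; _∧_; _∨_; _xor_; if_then_else_)
open import Data.List.Base using (List; []; _∷_; length; map; concatMap; applyUpTo; applyDownFrom; filterᵇ)
open import Data.Bool.ListAction using (all; any)
open import Data.Product using (_×_)
open import Relation.Binary.PropositionalEquality using (_≡_)

-- Sequences / permutations are written in one-line
-- notation as lists of naturals, indexed from 1 (as in the paper).
-- All finite predicates are Boolean-valued so that the finite sets
-- whose cardinalities are compared are explicit finite enumerations.

_==ᵇ_ : Bool → Bool → Bool
x ==ᵇ y = not (x xor y)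

range : ℕ → List ℕ
range n = applyUpTo suc n

-- 1-indexed lookup, 0 outside the list
at : List ℕ → ℕ → ℕ
at []       _             = 0
at (x ∷ xs) zero          = 0
at (x ∷ xs) (suc zero)    = x
at (x ∷ xs) (suc (suc i)) = at xs (suc i)

seqs : ℕ → ℕ → List (List ℕ)
seqs zero    m = [] ∷ []
seqs (suc l) m = concatMap (λ x → map (x ∷_) (seqs l m)) (range m)

increasing : List ℕ → Bool
increasing xs = all (λ i → at xs i <ᵇ at xs (suc i)) (range (length xs ∸ 1))

incSeqs : ℕ → ℕ → List (List ℕ)
incSeqs r m = filterᵇ increasing (seqs r m)

isPerm : List ℕ → Bool
isPerm w =
  all (λ i → (1 ≤ᵇ at w i) ∧ (at w i ≤ᵇ length w)) (range (length w)) ∧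
  all (λ i → all (λ j → (i <ᵇ j) xor' (at w i ≡ᵇ at w j)) (range (length w))) (range (length w))
  where
  -- for i < j the entries must differ
  _xor'_ : Bool → Bool → Bool
  true  xor' b = not b
  false xor' b = true

perms : ℕ → List (List ℕ)
perms n = filterᵇ isPerm (seqs n n)

decPerm : ℕ → List ℕ
decPerm k = applyDownFrom suc k

isAlternating : List ℕ → Bool
isAlternating w =
  all (λ i → if (i Data.Nat.Base.% 2) ≡ᵇ 1
             then at w i <ᵇ at w (suc i)
             else at w (suc i) <ᵇ at w i)
      (range (length w ∸ 1))
  where import Data.Nat.Base

containsPattern : List ℕ → List ℕ → Bool
containsPattern w q =
  any (λ ix → all (λ a → all (λ b →
          (at w (at ix a) <ᵇ at w (at ix b)) ==ᵇ (at q a <ᵇ at q b))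
        (range (length q))) (range (length q)))
      (incSeqs (length q) (length w))

A : ℕ → List ℕ → List (List ℕ)
A n q = filterᵇ (λ w → isAlternating w ∧ not (containsPattern w q)) (perms n)

M : List ℕ → ℕ → ℕ → Bool
M p i j = (1 ≤ᵇ i) ∧ (i ≤ᵇ length p) ∧ (at p i ≡ᵇ j)

J : ℕ → List ℕ
J k = decPerm k   -- the matrix J_k is M (J k)

-- AD-Young diagrams (rows 1..m, row i has length Y i; A, D as
-- characteristic functions of subsets of ℕ, required to lie in [m-1]).

record ADYoung : Set where
  field
    m        : ℕ
    Y        : ℕ → ℕ
    A' D'    : ℕ → Bool
    m-pos    : 1 ≤ m
    Y-first  : Y 1 ≡ m
    Y-decr   : ∀ i → 1 ≤ i → i < m → Y (suc i) ≤ Y i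
    Y-pos    : ∀ i → 1 ≤ i → i ≤ m → 1 ≤ Y i
    A-range  : ∀ i → A' i ≡ true → 1 ≤ i × i ≤ m ∸ 1
    D-range  : ∀ i → D' i ≡ true → 1 ≤ i × i ≤ m ∸ 1
    disjoint : ∀ i → A' i ≡ true → D' i ≡ false
    AD-equal : ∀ i → (A' i ∨ D' i) ≡ true → Y i ≡ Y (suc i)

open ADYoung public

TwoAlternating : ADYoung → Set
TwoAlternating 𝒴 = ∀ i → i + 2 ≤ m 𝒴 → A' 𝒴 i ≡ D' 𝒴 (suc i)

inY : ADYoung → ℕ → ℕ → Bool
inY 𝒴 i j = (1 ≤ᵇ i) ∧ (i ≤ᵇ m 𝒴) ∧ (1 ≤ᵇ j) ∧ (j ≤ᵇ Y 𝒴 i)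

-- t = (t₁ , … , t_m) ∈ [1..m]^m encodes T = {(i , t_i)}; it is a
-- transversal iff all squares lie in Y and columns are distinct
isTransversal : ADYoung → List ℕ → Bool
isTransversal 𝒴 t =
  all (λ i → inY 𝒴 i (at t i)) (range (m 𝒴)) ∧
  all (λ i → all (λ j → not (i <ᵇ j) ∨ not (at t i ≡ᵇ at t j)) (range (m 𝒴))) (range (m 𝒴))

isValid : ADYoung → List ℕ → Bool
isValid 𝒴 t =
  all (λ i → (not (A' 𝒴 i) ∨ (at t i <ᵇ at t (suc i))) ∧
             (not (D' 𝒴 i) ∨ (at t (suc i) <ᵇ at t i)))
      (range (m 𝒴 ∸ 1))

containsMatrix : ADYoung → List ℕ → List ℕ → Bool
containsMatrix 𝒴 t p =
  any (λ a → any (λ b →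
      inY 𝒴 (at a r) (at b r) ∧
      all (λ i → all (λ j → (at t (at a i) ≡ᵇ at b j) ==ᵇ M p i j) (range r)) (range r))
    (incSeqs r (m 𝒴))) (incSeqs r (m 𝒴))
  where r = length p

S : ADYoung → List ℕ → List (List ℕ)
S 𝒴 p = filterᵇ (λ t → isTransversal 𝒴 t ∧ isValid 𝒴 t ∧ not (containsMatrix 𝒴 t p))
                (seqs (m 𝒴) (m 𝒴))

ShapeEquiv2Alt : List ℕ → List ℕ → Set
ShapeEquiv2Alt p p' = ∀ (𝒴 : ADYoung) → TwoAlternating 𝒴 → length (S 𝒴 p) ≡ length (S 𝒴 p')

module Submission where

-- A permutation q ≠ δ_k of length k has an ascent q_{a+1} < q_{a+2}; put
-- k = a + s + 2 = K + 2 and n = 2K + 2.  The proof rests on three facts.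
--  * Pigeonhole: K + 2 increasing positions in [1 .. 2K+2] always contain
--    a pair 2j+1, 2j+2.  So a sequence that ascends at every odd position
--    has no descending subsequence of length K + 2.  Alternating
--    permutations, and valid transversals of the n×n square diagram with
--    A = odd rows and D = even rows, ascend at odd positions; hence they
--    all avoid δ_k, resp. J_k.
--  * Witness: there is an alternating permutation w of length n
--    containing q (shifted q sits on the positions 1,3,…,2a+1,2a+2,
--    2a+4,…,2K+2; large values fill the other peaks, small values the
--    other valleys).
--  * Counting: avoiders of q are avoiders of δ_k, and w is an avoider of
--    δ_k that is not one of q; so |A_n(q)| < |A_n(δ_k)|.  Read as a
--    transversal, w likewise gives |S(M(q))| < |S(J_k)|.
-- Matrices of different sizes are separated by the plain square diagram
-- of the smaller size: the larger matrix occurs in no transversal, the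
-- smaller one occurs in itself.

open import Defs
open import Data.Nat.Base using (ℕ; zero; suc; _+_; _*_; _∸_; _≤_; _<_; _≡ᵇ_; _<ᵇ_; _≤ᵇ_; z≤n; s≤s; _%_)
open import Data.Nat.Properties
open import Data.Nat.Divisibility using (_∣_; divides)
open import Data.Bool.Base using (Bool; true; false; not; T; _∧_; _∨_; if_then_else_)
open import Data.Bool.Properties using (T-≡)
open import Data.Bool.ListAction using (all; any)
open import Data.List.Base using (List; []; _∷_; length; map; concatMap; applyUpTo; applyDownFrom; filterᵇ)
open import Data.List.Properties using (length-applyUpTo; length-applyDownFrom)
open import Data.List.Membership.Propositional using (_∈_)
open import Data.List.Membership.Propositional.Properties using (∈-map⁺; ∈-map⁻; ∈-++⁺ˡ; ∈-++⁺ʳ; ∈-++⁻; ∈-applyUpTo⁺; ∈-applyUpTo⁻)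
open import Data.List.Relation.Unary.Any using (here; there)
open import Data.List.Relation.Unary.All using (All; []; _∷_)
open import Data.Product using (_×_; _,_; ∃-syntax; proj₁; proj₂)
open import Data.Sum using (_⊎_; inj₁; inj₂)
open import Data.Empty using (⊥-elim)
open import Function.Base using (_∘_)
open import Function.Bundles using (Equivalence)
open import Relation.Binary.PropositionalEquality hiding (J)
open import Relation.Binary.Definitions using (tri<; tri≈; tri>)
open import Relation.Nullary using (¬_; yes; no)
open import Data.Nat.Tactic.RingSolver using (solve-∀)

∧-true-l : ∀ {a b} → (a ∧ b) ≡ true → a ≡ true
∧-true-l {true} _ = refl

∧-true-r : ∀ {a b} → (a ∧ b) ≡ true → b ≡ true
∧-true-r {true} h = h

∧-true : ∀ {a b} → a ≡ true → b ≡ true → (a ∧ b) ≡ true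
∧-true refl refl = refl

==ᵇ-refl : ∀ b → (b ==ᵇ b) ≡ true
==ᵇ-refl true  = refl
==ᵇ-refl false = refl

==ᵇ-true : ∀ {x} → (x ==ᵇ true) ≡ true → x ≡ true
==ᵇ-true {true} _ = refl

true≢false : true ≢ false
true≢false ()

toT : ∀ {b} → b ≡ true → T b
toT = Equivalence.from T-≡

fromT : ∀ {b} → T b → b ≡ true
fromT = Equivalence.to T-≡

<ᵇ-sound : ∀ {m n} → (m <ᵇ n) ≡ true → m < n
<ᵇ-sound {m} {n} h = <ᵇ⇒< m n (toT h)

<ᵇ-complete : ∀ {m n} → m < n → (m <ᵇ n) ≡ true
<ᵇ-complete h = fromT (<⇒<ᵇ h)

<ᵇ-false : ∀ {m n} → n ≤ m → (m <ᵇ n) ≡ false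
<ᵇ-false {m} {n} h with m <ᵇ n in e
... | true  = ⊥-elim (<⇒≱ (<ᵇ-sound e) h)
... | false = refl

≤ᵇ-sound : ∀ {m n} → (m ≤ᵇ n) ≡ true → m ≤ n
≤ᵇ-sound {m} {n} h = ≤ᵇ⇒≤ m n (toT h)

≤ᵇ-complete : ∀ {m n} → m ≤ n → (m ≤ᵇ n) ≡ true
≤ᵇ-complete h = fromT (≤⇒≤ᵇ h)

≤ᵇ-false : ∀ {m n} → n < m → (m ≤ᵇ n) ≡ false
≤ᵇ-false {m} {n} h with m ≤ᵇ n in e
... | true  = ⊥-elim (<⇒≱ h (≤ᵇ-sound e))
... | false = refl

≡ᵇ-sound : ∀ {m n} → (m ≡ᵇ n) ≡ true → m ≡ n
≡ᵇ-sound {m} {n} h = ≡ᵇ⇒≡ m n (toT h)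

≡ᵇ-refl : ∀ m → (m ≡ᵇ m) ≡ true
≡ᵇ-refl m = fromT (≡⇒≡ᵇ m m refl)

≡ᵇ-false : ∀ {m n} → m ≢ n → (m ≡ᵇ n) ≡ false
≡ᵇ-false {m} {n} h with m ≡ᵇ n in e
... | true  = ⊥-elim (h (≡ᵇ-sound e))
... | false = refl

not-≡ᵇ-sound : ∀ {m n} → not (m ≡ᵇ n) ≡ true → m ≢ n
not-≡ᵇ-sound {m} h refl rewrite ≡ᵇ-refl m = true≢false (sym h)

not-≡ᵇ-complete : ∀ {m n} → m ≢ n → not (m ≡ᵇ n) ≡ true
not-≡ᵇ-complete m≢n rewrite ≡ᵇ-false m≢n = refl

+-<ᵇ : ∀ s m n → ((s + m) <ᵇ (s + n)) ≡ (m <ᵇ n)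
+-<ᵇ zero    m n = refl
+-<ᵇ (suc s) m n = +-<ᵇ s m n

+-≡ᵇ : ∀ s m n → ((s + m) ≡ᵇ (s + n)) ≡ (m ≡ᵇ n)
+-≡ᵇ zero    m n = refl
+-≡ᵇ (suc s) m n = +-≡ᵇ s m n

all-∈ : ∀ {A : Set} (f : A → Bool) {xs x} → all f xs ≡ true → x ∈ xs → f x ≡ true
all-∈ f {y ∷ ys} h (here refl) = ∧-true-l h
all-∈ f {y ∷ ys} h (there p)   = all-∈ f (∧-true-r {f y} h) p

all-intro : ∀ {A : Set} (f : A → Bool) xs → (∀ x → x ∈ xs → f x ≡ true) → all f xs ≡ true
all-intro f []       h = refl
all-intro f (x ∷ xs) h = ∧-true (h x (here refl)) (all-intro f xs (λ y p → h y (there p)))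

any-intro : ∀ {A : Set} (f : A → Bool) {xs x} → x ∈ xs → f x ≡ true → any f xs ≡ true
any-intro f {y ∷ ys} (here refl) h rewrite h = refl
any-intro f {y ∷ ys} (there p)   h with f y
... | true  = refl
... | false = any-intro f p h

any-false : ∀ {A : Set} (f : A → Bool) xs → (∀ x → x ∈ xs → f x ≢ true) → any f xs ≡ false
any-false f []       h = refl
any-false f (x ∷ xs) h with f x in e
... | true  = ⊥-elim (h x (here refl) e)
... | false = any-false f xs (λ y p → h y (there p))

filter⁺ : ∀ {A : Set} (f : A → Bool) {xs x} → x ∈ xs → f x ≡ true → x ∈ filterᵇ f xs
filter⁺ f {y ∷ ys} (here refl) h rewrite h = here refl
filter⁺ f {y ∷ ys} (there p)   h with f y
... | true  = there (filter⁺ f p h)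
... | false = filter⁺ f p h

filter⁻ : ∀ {A : Set} (f : A → Bool) {xs x} → x ∈ filterᵇ f xs → x ∈ xs × f x ≡ true
filter⁻ f {y ∷ ys} p with f y in e
filter⁻ f {y ∷ ys} (here refl) | true = here refl , e
filter⁻ f {y ∷ ys} (there p)   | true = let (q , fx) = filter⁻ f {ys} p in there q , fx
... | false = let (q , fx) = filter⁻ f {ys} p in there q , fx

filter-length-≤ : ∀ {A : Set} (P Q : A → Bool) xs → (∀ x → x ∈ xs → Q x ≡ true → P x ≡ true) →
  length (filterᵇ Q xs) ≤ length (filterᵇ P xs)
filter-length-≤ P Q []       Q⇒P = z≤n
filter-length-≤ P Q (x ∷ xs) Q⇒P with Q x in eQ | P x in eP
... | true  | true  = s≤s (filter-length-≤ P Q xs (λ y p → Q⇒P y (there p)))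
... | true  | false = ⊥-elim (true≢false (trans (sym (Q⇒P x (here refl) eQ)) eP))
... | false | true  = m≤n⇒m≤1+n (filter-length-≤ P Q xs (λ y p → Q⇒P y (there p)))
... | false | false = filter-length-≤ P Q xs (λ y p → Q⇒P y (there p))

filter-length-< : ∀ {A : Set} (P Q : A → Bool) xs → (∀ x → x ∈ xs → Q x ≡ true → P x ≡ true) →
  ∀ {w} → w ∈ xs → P w ≡ true → Q w ≡ false →
  length (filterᵇ Q xs) < length (filterᵇ P xs)
filter-length-< P Q (x ∷ xs) Q⇒P (here refl) Pw Qw rewrite Pw | Qw =
  s≤s (filter-length-≤ P Q xs (λ y p → Q⇒P y (there p)))
filter-length-< P Q (x ∷ xs) Q⇒P (there w∈) Pw Qw with Q x in eQ | P x in eP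
... | true  | true  = s≤s (filter-length-< P Q xs (λ y p → Q⇒P y (there p)) w∈ Pw Qw)
... | true  | false = ⊥-elim (true≢false (trans (sym (Q⇒P x (here refl) eQ)) eP))
... | false | true  = m≤n⇒m≤1+n (filter-length-< P Q xs (λ y p → Q⇒P y (there p)) w∈ Pw Qw)
... | false | false = filter-length-< P Q xs (λ y p → Q⇒P y (there p)) w∈ Pw Qw

concatMap⁺ : ∀ {A B : Set} (g : A → List B) {xs x y} → x ∈ xs → y ∈ g x → y ∈ concatMap g xs
concatMap⁺ g {x ∷ xs} (here refl) q = ∈-++⁺ˡ q
concatMap⁺ g {x ∷ xs} (there p)   q = ∈-++⁺ʳ (g x) (concatMap⁺ g p q)

concatMap⁻ : ∀ {A B : Set} (g : A → List B) xs {y} → y ∈ concatMap g xs → ∃[ x ] (x ∈ xs × y ∈ g x)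
concatMap⁻ g (x ∷ xs) p with ∈-++⁻ (g x) p
... | inj₁ q = x , here refl , q
... | inj₂ q = let (z , z∈ , q') = concatMap⁻ g xs q in z , there z∈ , q'

-- Ranges [1 .. m] and 1-indexed lookup.  Indices are written suc c with
-- c < m throughout.

InRange : ℕ → ℕ → Set
InRange m x = 1 ≤ x × x ≤ m

range⁻ : ∀ {m x} → x ∈ range m → ∃[ c ] (c < m × x ≡ suc c)
range⁻ p = ∈-applyUpTo⁻ suc p

range⁺ : ∀ {m c} → c < m → suc c ∈ range m
range⁺ = ∈-applyUpTo⁺ suc

all-range-intro : ∀ (f : ℕ → Bool) m → (∀ c → c < m → f (suc c) ≡ true) → all f (range m) ≡ true
all-range-intro f m h = all-intro f (range m) fx
  where
  fx : ∀ x → x ∈ range m → f x ≡ true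
  fx x p with range⁻ p
  ... | c , c<m , refl = h c c<m

all-range : ∀ (f : ℕ → Bool) m → all f (range m) ≡ true → ∀ c → c < m → f (suc c) ≡ true
all-range f m h c c<m = all-∈ f h (range⁺ c<m)

all-pairs : ∀ (f : ℕ → Bool) m → all f (range (m ∸ 1)) ≡ true → ∀ c → suc c < m → f (suc c) ≡ true
all-pairs f (suc m) h c (s≤s c<m) = all-range f m h c c<m

all-pairs-intro : ∀ (f : ℕ → Bool) m → (∀ c → suc c < m → f (suc c) ≡ true) → all f (range (m ∸ 1)) ≡ true
all-pairs-intro f zero    h = refl
all-pairs-intro f (suc m) h = all-range-intro f m (λ c c<m → h c (s≤s c<m))

at-applyUpTo : ∀ (h : ℕ → ℕ) n c → c < n → at (applyUpTo h n) (suc c) ≡ h c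
at-applyUpTo h (suc n) zero    _         = refl
at-applyUpTo h (suc n) (suc c) (s≤s c<n) = at-applyUpTo (λ x → h (suc x)) n c c<n

at-applyDownFrom : ∀ (f : ℕ → ℕ) n c → c < n → at (applyDownFrom f n) (suc c) ≡ f (n ∸ suc c)
at-applyDownFrom f (suc n) zero    _         = refl
at-applyDownFrom f (suc n) (suc c) (s≤s c<n) = at-applyDownFrom f n c c<n

at-range : ∀ n c → c < n → at (range n) (suc c) ≡ suc c
at-range = at-applyUpTo suc

All-at : ∀ {P : ℕ → Set} {xs} → All P xs → ∀ c → c < length xs → P (at xs (suc c))
All-at (px ∷ pxs) zero    _ = px
All-at {xs = x ∷ y ∷ xs} (px ∷ pxs) (suc c) (s≤s c<) = All-at pxs c c<

at-All : ∀ {P : ℕ → Set} xs → (∀ c → c < length xs → P (at xs (suc c))) → All P xs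
at-All []       h = []
at-All (x ∷ xs) h = h 0 (s≤s z≤n) ∷ at-All xs (λ c c< → h (suc c) (s≤s c<))

at-ext : ∀ (xs ys : List ℕ) → length xs ≡ length ys →
  (∀ c → c < length xs → at xs (suc c) ≡ at ys (suc c)) → xs ≡ ys
at-ext []       []       _  _ = refl
at-ext (x ∷ xs) (y ∷ ys) le h =
  cong₂ _∷_ (h 0 (s≤s z≤n)) (at-ext xs ys (suc-injective le) (λ c c< → h (suc c) (s≤s c<)))

∧-false : ∀ a b → (a ∧ b) ≡ false → a ≡ false ⊎ b ≡ false
∧-false false b _ = inj₁ refl
∧-false true  b h = inj₂ h

all-range-false : ∀ (f : ℕ → Bool) m → all f (range m) ≡ false → ∃[ c ] (c < m × f (suc c) ≡ false)
all-range-false f m h = go (range m) h (λ x p → p)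
  where
  go : ∀ xs → all f xs ≡ false → (∀ x → x ∈ xs → x ∈ range m) → ∃[ c ] (c < m × f (suc c) ≡ false)
  go (x ∷ xs) h sub with f x in e
  ... | true  = go xs h (λ y p → sub y (there p))
  ... | false with range⁻ (sub x (here refl))
  ...   | c , c<m , refl = c , c<m , e

seqs⁺ : ∀ l m xs → length xs ≡ l → All (InRange m) xs → xs ∈ seqs l m
seqs⁺ zero    m []       _  _ = here refl
seqs⁺ (suc l) m (x ∷ xs) le ((s≤s z≤n , x≤m) ∷ bs) =
  concatMap⁺ (λ y → map (y ∷_) (seqs l m)) (range⁺ x≤m) (∈-map⁺ (x ∷_) (seqs⁺ l m xs (suc-injective le) bs))

seqs⁻ : ∀ l m xs → xs ∈ seqs l m → length xs ≡ l × All (InRange m) xs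
seqs⁻ zero    m []       _ = refl , []
seqs⁻ zero    m (x ∷ xs) (here ())
seqs⁻ zero    m (x ∷ xs) (there ())
seqs⁻ (suc l) m xs p with concatMap⁻ (λ y → map (y ∷_) (seqs l m)) (range m) p
... | y , y∈ , q with ∈-map⁻ (y ∷_) q
... | ys , ys∈ , refl with seqs⁻ l m ys ys∈ | range⁻ y∈
... | le , bs | c , c<m , refl = cong suc le , ((s≤s z≤n , c<m) ∷ bs)

record IncSeq (r m : ℕ) (ix : List ℕ) : Set where
  field
    length≡    : length ix ≡ r
    bounded    : ∀ c → c < r → InRange m (at ix (suc c))
    ascending  : ∀ c → suc c < r → at ix (suc c) < at ix (suc (suc c))

incSeqs⁻ : ∀ {r m ix} → ix ∈ incSeqs r m → IncSeq r m ix
incSeqs⁻ {r} {m} {ix} p with filter⁻ increasing {seqs r m} p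
... | ix∈ , inc with seqs⁻ r m ix ix∈
... | refl , bs = record
  { length≡    = refl
  ; bounded    = All-at bs
  ; ascending  = λ c c+1<r → <ᵇ-sound (all-pairs _ (length ix) inc c c+1<r) }

incSeqs⁺ : ∀ {r m ix} → IncSeq r m ix → ix ∈ incSeqs r m
incSeqs⁺ {r} {m} {ix} I with IncSeq.length≡ I
... | refl = filter⁺ increasing (seqs⁺ r m ix refl (at-All ix (IncSeq.bounded I)))
  (all-pairs-intro _ (length ix) λ c c+1<r → <ᵇ-complete (IncSeq.ascending I c c+1<r))

applyUpTo-IncSeq : ∀ {r m} (h : ℕ → ℕ) → (∀ c → c < r → InRange m (h c)) →
  (∀ c → suc c < r → h c < h (suc c)) → IncSeq r m (applyUpTo h r)
applyUpTo-IncSeq {r} {m} h bd inc = record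
  { length≡    = length-applyUpTo h r
  ; bounded    = λ c c<r → subst (InRange m) (sym (at-applyUpTo h r c c<r)) (bd c c<r)
  ; ascending  = λ c c+1<r → subst₂ _<_ (sym (at-applyUpTo h r c (<-trans (n<1+n c) c+1<r)))
                                       (sym (at-applyUpTo h r (suc c) c+1<r)) (inc c c+1<r) }

-- An increasing sequence of length r has c-th entry ≥ c, so it cannot
-- live in [1 .. m] when m < r.
IncSeq-≥ : ∀ {r m ix} → IncSeq r m ix → ∀ c → c < r → suc c ≤ at ix (suc c)
IncSeq-≥ I zero    c<r = proj₁ (IncSeq.bounded I 0 c<r)
IncSeq-≥ I (suc c) c<r = ≤-trans (s≤s (IncSeq-≥ I c (<⇒≤ c<r))) (IncSeq.ascending I c c<r)

IncSeq-too-long : ∀ {r m ix} → m < r → ¬ IncSeq r m ix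
IncSeq-too-long {suc r} m<r I = <⇒≱ m<r (≤-trans (IncSeq-≥ I r ≤-refl) (proj₂ (IncSeq.bounded I r ≤-refl)))

record Perm (w : List ℕ) : Set where
  field
    bounded   : ∀ c → c < length w → InRange (length w) (at w (suc c))
    injective : ∀ c c' → c < c' → c' < length w → at w (suc c) ≢ at w (suc c')

isPerm⇒Perm : ∀ w → isPerm w ≡ true → Perm w
isPerm⇒Perm w h = record { bounded = bounded ; injective = injective }
  where
  L = length w
  bounded : ∀ c → c < L → InRange L (at w (suc c))
  bounded c c<L = let b = all-range _ L (∧-true-l h) c c<L in
    ≤ᵇ-sound (∧-true-l b) , ≤ᵇ-sound (∧-true-r {1 ≤ᵇ at w (suc c)} b)
  injective : ∀ c c' → c < c' → c' < L → at w (suc c) ≢ at w (suc c')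
  injective c c' c<c' c'<L
    with suc c <ᵇ suc c' | <ᵇ-complete (s≤s c<c')
       | all-range _ L (all-range _ L (∧-true-r {all _ (range L)} h) c (<-trans c<c' c'<L)) c' c'<L
  ... | .true | refl | distinct = not-≡ᵇ-sound distinct

Perm⇒isPerm : ∀ w → Perm w → isPerm w ≡ true
Perm⇒isPerm w P with isPerm w in e
... | true = refl
... | false with ∧-false _ _ e
...   | inj₁ bad-entry with all-range-false _ (length w) bad-entry
...     | c , c<L , fails = ⊥-elim (true≢false (trans (sym (∧-true (≤ᵇ-complete (proj₁ b)) (≤ᵇ-complete (proj₂ b)))) fails))
  where b = Perm.bounded P c c<L
Perm⇒isPerm w P | false | inj₂ bad-pair with all-range-false _ (length w) bad-pair
... | c , _ , fails with all-range-false _ (length w) fails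
... | c' , c'<L , fails' with suc c <ᵇ suc c' in c<ᵇc' | fails'
... | true  | repeated = ⊥-elim (true≢false (trans (sym (not-≡ᵇ-complete
                            (Perm.injective P c c' (≤-pred (<ᵇ-sound c<ᵇc')) c'<L))) repeated))
... | false | ()

Perm⇒seqs : ∀ w → Perm w → w ∈ seqs (length w) (length w)
Perm⇒seqs w P = seqs⁺ _ _ w refl (at-All w (Perm.bounded P))

length-decPerm : ∀ k → length (decPerm k) ≡ k
length-decPerm = length-applyDownFrom suc

suc-∸-suc : ∀ {c k} → c < k → suc (k ∸ suc c) ≡ k ∸ c
suc-∸-suc {c} {suc k} (s≤s c<k) = sym (+-∸-assoc 1 c<k)

at-decPerm : ∀ k c → c < k → at (decPerm k) (suc c) ≡ k ∸ c
at-decPerm k c c<k = trans (at-applyDownFrom suc k c c<k) (suc-∸-suc c<k)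

Descending : List ℕ → Set
Descending q = ∀ c → suc c < length q → at q (suc (suc c)) < at q (suc c)

decPerm-Perm : ∀ k → Perm (decPerm k)
decPerm-Perm k = record
  { bounded   = λ c c<L → let c<k = subst (c <_) (length-decPerm k) c<L in
      subst (InRange (length (decPerm k))) (sym (at-decPerm k c c<k))
        (subst (λ z → InRange z (k ∸ c)) (sym (length-decPerm k)) (m<n⇒0<n∸m c<k , m∸n≤m k c))
  ; injective = λ c c' c<c' c'<L → let c'<k = subst (c' <_) (length-decPerm k) c'<L in
      λ eq → <-irrefl (trans (sym (at-decPerm k c' c'<k)) (trans (sym eq) (at-decPerm k c (<-trans c<c' c'<k))))
                      (∸-monoʳ-< c<c' (<⇒≤ c'<k)) }

decPerm-Descending : ∀ k → Descending (decPerm k)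
decPerm-Descending k c c+1<L = subst₂ _<_ (sym (at-decPerm k (suc c) c+1<k)) (sym (at-decPerm k c (<-trans (n<1+n c) c+1<k)))
  (∸-monoʳ-< (n<1+n c) (<⇒≤ c+1<k))
  where c+1<k = subst (suc c <_) (length-decPerm k) c+1<L

-- δ_k is the only descending permutation of length k: the entries are
-- squeezed between k - c (descending from an entry ≤ k) and k - c
-- (descending to an entry ≥ 1).
Descending⇒decPerm : ∀ k q → length q ≡ k → Perm q → Descending q → q ≡ decPerm k
Descending⇒decPerm k q refl P desc = at-ext q (decPerm k) (sym (length-decPerm k)) λ c c<k →
  trans (≤-antisym (upper c c<k) (subst (_≤ at q (suc c)) (suc-∸-suc c<k) (lower (k ∸ suc c) c (m+[n∸m]≡n c<k))))
        (sym (at-decPerm k c c<k))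
  where
  upper : ∀ c → c < k → at q (suc c) ≤ k ∸ c
  upper zero    c<k = proj₂ (Perm.bounded P 0 c<k)
  upper (suc c) c<k = subst (at q (suc (suc c)) ≤_) (pred[m∸n]≡m∸[1+n] k c)
    (<⇒≤pred (≤-trans (desc c c<k) (upper c (<-trans (n<1+n c) c<k))))
  lower : ∀ d c → suc c + d ≡ k → suc d ≤ at q (suc c)
  lower zero    c eq = proj₁ (Perm.bounded P c (subst (c <_) (trans (sym (+-identityʳ (suc c))) eq) ≤-refl))
  lower (suc d) c eq = ≤-trans (s≤s (lower d (suc c) (trans (sym (+-suc (suc c) d)) eq))) (desc c c+1<k)
    where
    c+1<k : suc c < k
    c+1<k = subst (suc c <_) eq (s≤s (subst (suc c ≤_) (sym (+-suc c d)) (s≤s (m≤m+n c d))))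

ascent : ∀ k q → length q ≡ k → Perm q → q ≢ decPerm k →
  ∃[ a ] (suc a < k × at q (suc a) < at q (suc (suc a)))
ascent k q lq P q≢δ with anyUpTo? (λ c → at q (suc c) <? at q (suc (suc c))) (k ∸ 1)
... | yes (a , a<k-1 , up) = a , lt-pred a<k-1 , up
  where
  lt-pred : ∀ {c L} → c < L ∸ 1 → suc c < L
  lt-pred {L = suc L} c<L = s≤s c<L
... | no no-ascent = ⊥-elim (q≢δ (Descending⇒decPerm k q lq P descends))
  where
  descends : Descending q
  descends c c+1<L with <-cmp (at q (suc (suc c))) (at q (suc c))
  ... | tri< down _ _ = down
  ... | tri≈ _ eq _   = ⊥-elim (Perm.injective P c (suc c) (n<1+n c) c+1<L (sym eq))
  ... | tri> _ _ up   = ⊥-elim (no-ascent (c , pred-< (subst (suc c <_) lq c+1<L) , up))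
    where
    pred-< : ∀ {c L} → suc c < L → c < L ∸ 1
    pred-< {L = suc L} (s≤s c<L) = c<L

data Parity : ℕ → Set where
  even : ∀ j → Parity (j + j)
  odd  : ∀ j → Parity (suc (j + j))

parity : ∀ n → Parity n
parity zero          = even 0
parity (suc zero)    = odd 0
parity (suc (suc n)) with parity n
... | even j = subst Parity (cong suc (+-suc j j)) (even (suc j))
... | odd  j = subst Parity (cong (suc ∘ suc) (+-suc j j)) (odd (suc j))

even-%2 : ∀ j → (j + j) % 2 ≡ 0
even-%2 zero    = refl
even-%2 (suc j) rewrite +-suc j j = even-%2 j

odd-%2 : ∀ j → suc (j + j) % 2 ≡ 1
odd-%2 zero    = refl
odd-%2 (suc j) rewrite +-suc j j = odd-%2 j

half-< : ∀ {c j} → c + c < j + j → c < j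
half-< {c} {j} h with c <? j
... | yes c<j = c<j
... | no  c≮j = ⊥-elim (<⇒≱ h (+-mono-≤ (≮⇒≥ c≮j) (≮⇒≥ c≮j)))

half-≤ : ∀ {c j} → c + c ≤ j + j → c ≤ j
half-≤ {c} {j} h with c ≤? j
... | yes c≤j = c≤j
... | no  c≰j = ⊥-elim (<⇒≱ (+-mono-< (≰⇒> c≰j) (≰⇒> c≰j)) h)

scan-step : ∀ {c x y} → c + c < x → x < y →
  (∃[ j ] (x ≡ suc (j + j) × y ≡ suc (suc (j + j)))) ⊎ (suc c + suc c < y)
scan-step {c} {x} {y} c+c<x x<y with parity x
... | even j = inj₂ (≤-<-trans (+-mono-≤ c<j c<j) x<y)
  where c<j = half-< {c} {j} c+c<x
... | odd j with y ≟ suc (suc (j + j))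
...   | yes y≡ = inj₁ (j , refl , y≡)
...   | no  y≢ = inj₂ (≤-<-trans (subst (_≤ suc (suc (j + j))) (cong suc (sym (+-suc c c))) (s≤s (s≤s c+c≤j+j)))
                                 (≤∧≢⇒< x<y (y≢ ∘ sym)))
  where
  c+c≤j+j : c + c ≤ j + j
  c+c≤j+j = +-mono-≤ c≤j c≤j where c≤j = half-≤ {c} {j} (≤-pred c+c<x)

-- Pigeonhole: K+2 increasing positions in [1 .. 2K+2] include two
-- consecutive ones of the form 2j+1, 2j+2.  Otherwise the scan shows that
-- the last position exceeds 2(K+1).
pigeonhole : ∀ K ix → IncSeq (suc (suc K)) (suc K + suc K) ix →
  ∃[ c ] ∃[ j ] (suc c < suc (suc K) × at ix (suc c) ≡ suc (j + j) × at ix (suc (suc c)) ≡ suc (suc (j + j)))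
pigeonhole K ix I with scan (suc K) ≤-refl
  where
  Pair = ∃[ c ] ∃[ j ] (suc c < suc (suc K) × at ix (suc c) ≡ suc (j + j) × at ix (suc (suc c)) ≡ suc (suc (j + j)))
  scan : ∀ c → c < suc (suc K) → Pair ⊎ (c + c < at ix (suc c))
  scan zero    c<r = inj₂ (proj₁ (IncSeq.bounded I 0 c<r))
  scan (suc c) c<r with scan c (<⇒≤ c<r)
  ... | inj₁ pair = inj₁ pair
  ... | inj₂ c+c<x with scan-step c+c<x (IncSeq.ascending I c c<r)
  ...   | inj₁ (j , x≡ , y≡) = inj₁ (c , j , c<r , x≡ , y≡)
  ...   | inj₂ bigger        = inj₂ bigger
... | inj₁ pair = pair
... | inj₂ big  = ⊥-elim (<⇒≱ big (proj₂ (IncSeq.bounded I (suc K) ≤-refl)))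

OddAscents : ℕ → List ℕ → Set
OddAscents n w = ∀ j → suc (suc (j + j)) ≤ n → at w (suc (j + j)) < at w (suc (suc (j + j)))

odd-ascents-rise : ∀ K w ix → OddAscents (suc K + suc K) w → IncSeq (suc (suc K)) (suc K + suc K) ix →
  ∃[ c ] (suc c < suc (suc K) × at w (at ix (suc c)) < at w (at ix (suc (suc c))))
odd-ascents-rise K w ix rises I with pigeonhole K ix I
... | c , j , c+1<r , x≡ , y≡ = c , c+1<r ,
  subst₂ (λ x y → at w x < at w y) (sym x≡) (sym y≡)
    (rises j (subst (_≤ suc K + suc K) y≡ (proj₂ (IncSeq.bounded I (suc c) c+1<r))))

InRange⇒∈range : ∀ {m x} → InRange m x → x ∈ range m
InRange⇒∈range (s≤s z≤n , x≤m) = range⁺ x≤m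

IncSeq-mono : ∀ {r m ix} → IncSeq r m ix → ∀ c d → c < d → d < r → at ix (suc c) < at ix (suc d)
IncSeq-mono I c (suc d) c<d+1 d+1<r with m≤n⇒m<n∨m≡n (≤-pred c<d+1)
... | inj₁ c<d  = <-trans (IncSeq-mono I c d c<d (<-trans (n<1+n d) d+1<r)) (IncSeq.ascending I d d+1<r)
... | inj₂ refl = IncSeq.ascending I c d+1<r

IncSeq-mono-InRange : ∀ {r m ix x y} → IncSeq r m ix → InRange r x → InRange r y → x < y → at ix x < at ix y
IncSeq-mono-InRange {x = suc x} {suc y} I _ (_ , y≤r) (s≤s x<y) = IncSeq-mono I x y x<y y≤r

comparison-mismatch : ∀ {x y u v} → x < y → v < u → ((x <ᵇ y) ==ᵇ (u <ᵇ v)) ≢ true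
comparison-mismatch x<y v<u rewrite <ᵇ-complete x<y | <ᵇ-false (<⇒≤ v<u) = λ ()

odd-ascents-avoid-pattern : ∀ K w q → length w ≡ suc K + suc K → OddAscents (suc K + suc K) w →
  length q ≡ suc (suc K) → Descending q → containsPattern w q ≡ false
odd-ascents-avoid-pattern K w q lw rises lq desc = any-false _ _ no-occurrence
  where
  no-occurrence : ∀ ix → ix ∈ incSeqs (length q) (length w) →
    all (λ a → all (λ b → (at w (at ix a) <ᵇ at w (at ix b)) ==ᵇ (at q a <ᵇ at q b))
      (range (length q))) (range (length q)) ≢ true
  no-occurrence ix ix∈ occurs with odd-ascents-rise K w ix rises (subst₂ (λ r n → IncSeq r n ix) lq lw (incSeqs⁻ ix∈))
  ... | c , c+1<r , rise = comparison-mismatch rise (desc c c+1<L)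
          (all-range _ _ (all-range _ _ occurs c (<-trans (n<1+n c) c+1<L)) (suc c) c+1<L)
    where c+1<L = subst (suc c <_) (sym lq) c+1<r

M-diagonal : ∀ p c → c < length p → M p (suc c) (at p (suc c)) ≡ true
M-diagonal p c c<r rewrite ≤ᵇ-complete c<r | ≡ᵇ-refl (at p (suc c)) = refl

occurrence-column : ∀ t p a b → Perm p →
  all (λ i → all (λ j → (at t (at a i) ≡ᵇ at b j) ==ᵇ M p i j) (range (length p))) (range (length p)) ≡ true →
  ∀ c → c < length p → at t (at a (suc c)) ≡ at b (at p (suc c))
occurrence-column t p a b P occ c c<r = ≡ᵇ-sound (==ᵇ-true
  (subst (λ z → ((at t (at a (suc c)) ≡ᵇ at b (at p (suc c))) ==ᵇ z) ≡ true) (M-diagonal p c c<r)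
    (all-∈ _ (all-range _ (length p) occ c c<r) (InRange⇒∈range (Perm.bounded P c c<r)))))

odd-ascents-avoid-matrix : ∀ K 𝒴 t p → m 𝒴 ≡ suc K + suc K → OddAscents (suc K + suc K) t →
  length p ≡ suc (suc K) → Perm p → Descending p → containsMatrix 𝒴 t p ≡ false
odd-ascents-avoid-matrix K 𝒴 t p m≡ rises lp P desc =
  any-false _ _ λ a a∈ some-b → true≢false (trans (sym some-b) (any-false _ _ λ b b∈ occ →
    no-occurrence a b (incSeqs⁻ a∈) (incSeqs⁻ b∈) (∧-true-r {inY 𝒴 (at a r) (at b r)} occ)))
  where
  r = length p
  no-occurrence : ∀ a b → IncSeq r (m 𝒴) a → IncSeq r (m 𝒴) b →
    all (λ i → all (λ j → (at t (at a i) ≡ᵇ at b j) ==ᵇ M p i j) (range r)) (range r) ≢ true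
  no-occurrence a b Ia Ib occ with odd-ascents-rise K t a rises (subst₂ (λ r n → IncSeq r n a) lp m≡ Ia)
  ... | c , c+1<k , rise = <-asym rise (subst₂ _<_ (sym (column (suc c) c+1<r)) (sym (column c (<-trans (n<1+n c) c+1<r)))
          (IncSeq-mono-InRange Ib (Perm.bounded P (suc c) c+1<r) (Perm.bounded P c (<-trans (n<1+n c) c+1<r)) (desc c c+1<r)))
    where
    c+1<r = subst (suc c <_) (sym lp) c+1<k
    column = occurrence-column t p a b P occ

too-large-avoided : ∀ 𝒴 t p → m 𝒴 < length p → containsMatrix 𝒴 t p ≡ false
too-large-avoided 𝒴 t p m<r = any-false _ _ λ a a∈ _ → IncSeq-too-long m<r (incSeqs⁻ a∈)

shifted-copy⇒containsPattern : ∀ w q s ix → IncSeq (length q) (length w) ix →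
  (∀ c → c < length q → at w (at ix (suc c)) ≡ s + at q (suc c)) → containsPattern w q ≡ true
shifted-copy⇒containsPattern w q s ix I copy =
  any-intro _ (incSeqs⁺ I) (all-range-intro _ r λ c c<r → all-range-intro _ r (same-order c c<r))
  where
  r = length q
  same-order : ∀ c → c < r → ∀ c' → c' < r →
    ((at w (at ix (suc c)) <ᵇ at w (at ix (suc c'))) ==ᵇ (at q (suc c) <ᵇ at q (suc c'))) ≡ true
  same-order c c<r c' c'<r rewrite copy c c<r | copy c' c'<r | +-<ᵇ s (at q (suc c)) (at q (suc c')) =
    ==ᵇ-refl (at q (suc c) <ᵇ at q (suc c'))

last-InRange : ∀ {r m ix} → 1 ≤ r → IncSeq r m ix → InRange m (at ix r)
last-InRange {suc r} _ I = IncSeq.bounded I r ≤-refl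

module Square (N : ℕ) (N≥1 : 1 ≤ N) (A D : ℕ → Bool)
              (A-range : ∀ i → A i ≡ true → 1 ≤ i × i ≤ N ∸ 1)
              (D-range : ∀ i → D i ≡ true → 1 ≤ i × i ≤ N ∸ 1)
              (A∩D=∅ : ∀ i → A i ≡ true → D i ≡ false) where

  diagram : ADYoung
  diagram = record
    { m = N ; Y = λ _ → N ; A' = A ; D' = D ; m-pos = N≥1 ; Y-first = refl
    ; Y-decr = λ _ _ _ → ≤-refl ; Y-pos = λ _ _ _ → N≥1 ; A-range = A-range ; D-range = D-range
    ; disjoint = A∩D=∅ ; AD-equal = λ _ _ → refl }

  inY-square : ∀ {i j} → InRange N i → InRange N j → inY diagram i j ≡ true
  inY-square (1≤i , i≤N) (1≤j , j≤N) =
    ∧-true (≤ᵇ-complete 1≤i) (∧-true (≤ᵇ-complete i≤N) (∧-true (≤ᵇ-complete 1≤j) (≤ᵇ-complete j≤N)))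

  Perm⇒transversal : ∀ t → length t ≡ N → Perm t → isTransversal diagram t ≡ true
  Perm⇒transversal t refl P = ∧-true
    (all-range-intro _ N λ c c<N → let (1≤x , x≤N) = Perm.bounded P c c<N in
      ∧-true refl (∧-true (≤ᵇ-complete c<N) (∧-true (≤ᵇ-complete 1≤x) (≤ᵇ-complete x≤N))))
    (all-range-intro _ N λ c c<N → all-range-intro _ N (distinct c))
    where
    distinct : ∀ c c' → c' < N → (not (suc c <ᵇ suc c') ∨ not (at t (suc c) ≡ᵇ at t (suc c'))) ≡ true
    distinct c c' c'<N with suc c <ᵇ suc c' in c<ᵇc'
    ... | false = refl
    ... | true  = not-≡ᵇ-complete (Perm.injective P c c' (≤-pred (<ᵇ-sound c<ᵇc')) c'<N)

  shifted-copy⇒containsMatrix : ∀ t p s a → 1 ≤ length p → Perm p → IncSeq (length p) N a →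
    s + length p ≤ N → (∀ c → c < length p → at t (at a (suc c)) ≡ s + at p (suc c)) →
    containsMatrix diagram t p ≡ true
  shifted-copy⇒containsMatrix t p s a r≥1 P Ia s+r≤N copy =
    any-intro _ (incSeqs⁺ Ia) (any-intro _ (incSeqs⁺ Ib)
      (∧-true (inY-square (last-InRange r≥1 Ia) (last-InRange r≥1 Ib))
              (all-range-intro _ r λ c c<r → all-range-intro _ r (entry c c<r))))
    where
    r = length p
    columns = applyUpTo (λ c → s + suc c) r
    Ib : IncSeq r N columns
    Ib = applyUpTo-IncSeq _ (λ c c<r → subst (1 ≤_) (sym (+-suc s c)) (s≤s z≤n) , ≤-trans (+-monoʳ-≤ s c<r) s+r≤N) (λ c _ → +-monoʳ-< s ≤-refl)
    entry : ∀ c → c < r → ∀ c' → c' < r →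
      ((at t (at a (suc c)) ≡ᵇ at columns (suc c')) ==ᵇ M p (suc c) (suc c')) ≡ true
    entry c c<r c' c'<r rewrite copy c c<r | at-applyUpTo (λ c → s + suc c) r c' c'<r
                              | +-≡ᵇ s (at p (suc c)) (suc c') | ≤ᵇ-complete c<r =
      ==ᵇ-refl (at p (suc c) ≡ᵇ suc c')

EvenDescents : ℕ → List ℕ → Set
EvenDescents n w = ∀ j → suc (suc (suc (j + j))) ≤ n → at w (suc (suc (suc (j + j)))) < at w (suc (suc (j + j)))

odd-test : ∀ j → (suc (j + j) % 2 ≡ᵇ 1) ≡ true
odd-test j = cong (_≡ᵇ 1) (odd-%2 j)

even-test : ∀ j → ((j + j) % 2 ≡ᵇ 1) ≡ false
even-test j = cong (_≡ᵇ 1) (even-%2 j)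

isAlternating⇒OddAscents : ∀ w → isAlternating w ≡ true → OddAscents (length w) w
isAlternating⇒OddAscents w alt j bound with all-pairs _ (length w) alt (j + j) bound
... | rise rewrite odd-test j = <ᵇ-sound rise

alternating : ∀ w → OddAscents (length w) w → EvenDescents (length w) w → isAlternating w ≡ true
alternating w rises falls = all-pairs-intro _ (length w) step
  where
  step : ∀ c → suc c < length w →
    (if (suc c % 2) ≡ᵇ 1 then at w (suc c) <ᵇ at w (suc (suc c)) else at w (suc (suc c)) <ᵇ at w (suc c)) ≡ true
  step c bound with parity c
  ... | even j rewrite odd-test j  = <ᵇ-complete (rises j bound)
  ... | odd j  rewrite even-test j = <ᵇ-complete (falls j bound)

never : ℕ → Bool
never _ = false

module Plain (N : ℕ) (N≥1 : 1 ≤ N) = Square N N≥1 never never (λ _ ()) (λ _ ()) (λ _ ())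

plain-2alt : ∀ N N≥1 → TwoAlternating (Plain.diagram N N≥1)
plain-2alt N N≥1 i _ = refl

plain-valid : ∀ N N≥1 t → isValid (Plain.diagram N N≥1) t ≡ true
plain-valid N N≥1 t = all-intro _ (range (N ∸ 1)) (λ _ _ → refl)

oddRows : ℕ → ℕ → Bool
oddRows N i = ((i % 2) ≡ᵇ 1) ∧ (i <ᵇ N)

evenRows : ℕ → ℕ → Bool
evenRows N i = ((i % 2) ≡ᵇ 0) ∧ ((0 <ᵇ i) ∧ (i <ᵇ N))

below-pred : ∀ {i N} → (i <ᵇ N) ≡ true → i ≤ N ∸ 1
below-pred {i} {suc N} h = ≤-pred (<ᵇ-sound h)

oddRows-range : ∀ N i → oddRows N i ≡ true → 1 ≤ i × i ≤ N ∸ 1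
oddRows-range N (suc i) h = s≤s z≤n , below-pred {N = N} (∧-true-r {(suc i % 2) ≡ᵇ 1} h)

evenRows-range : ∀ N i → evenRows N i ≡ true → 1 ≤ i × i ≤ N ∸ 1
evenRows-range N (suc i) h = s≤s z≤n , below-pred {N = N} (∧-true-r {(suc i % 2) ≡ᵇ 0} h)

odd-even-disjoint : ∀ N i → oddRows N i ≡ true → evenRows N i ≡ false
odd-even-disjoint N i h with parity i
... | even j rewrite even-test j = ⊥-elim (true≢false (sym h))
... | odd j  rewrite odd-%2 j    = refl

module Alternating (N : ℕ) (N≥1 : 1 ≤ N) =
  Square N N≥1 (oddRows N) (evenRows N) (oddRows-range N) (evenRows-range N) (odd-even-disjoint N)

parity-flip : ∀ i → ((suc i % 2) ≡ᵇ 0) ≡ ((i % 2) ≡ᵇ 1)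
parity-flip zero          = refl
parity-flip (suc zero)    = refl
parity-flip (suc (suc i)) = parity-flip i

alternating-2alt : ∀ N N≥1 → TwoAlternating (Alternating.diagram N N≥1)
alternating-2alt N N≥1 i i+2≤N
  rewrite parity-flip i | +-comm i 2 | <ᵇ-complete {i} {N} (<-trans (n<1+n i) i+2≤N) | <ᵇ-complete i+2≤N = refl

or-elim : ∀ {a b} → (not a ∨ b) ≡ true → a ≡ true → b ≡ true
or-elim h refl = h

valid⇒OddAscents : ∀ N N≥1 t → isValid (Alternating.diagram N N≥1) t ≡ true → OddAscents N t
valid⇒OddAscents N N≥1 t valid j bound = <ᵇ-sound (or-elim (∧-true-l (all-pairs _ N valid (j + j) bound))
  (∧-true (odd-test j) (<ᵇ-complete bound)))

valid : ∀ N N≥1 t → OddAscents N t → EvenDescents N t → isValid (Alternating.diagram N N≥1) t ≡ true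
valid N N≥1 t rises falls = all-pairs-intro _ N step
  where
  step : ∀ c → suc c < N → ((not (oddRows N (suc c)) ∨ (at t (suc c) <ᵇ at t (suc (suc c)))) ∧
                            (not (evenRows N (suc c)) ∨ (at t (suc (suc c)) <ᵇ at t (suc c)))) ≡ true
  step c bound with parity c
  ... | even j rewrite odd-%2 j  | <ᵇ-complete (rises j bound) | <ᵇ-complete bound = refl
  ... | odd j  rewrite even-%2 j | <ᵇ-complete (falls j bound) | <ᵇ-complete bound = refl

-- Interleaving two sequences: position 2j holds o j, position 2j+1 holds e j.

interleave : (ℕ → ℕ) → (ℕ → ℕ) → ℕ → ℕ
interleave o e zero          = o 0
interleave o e (suc zero)    = e 0
interleave o e (suc (suc p)) = interleave (o ∘ suc) (e ∘ suc) p

interleave-even : ∀ o e j → interleave o e (j + j) ≡ o j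
interleave-even o e zero    = refl
interleave-even o e (suc j) rewrite +-suc j j = interleave-even (o ∘ suc) (e ∘ suc) j

interleave-odd : ∀ o e j → interleave o e (suc (j + j)) ≡ e j
interleave-odd o e zero    = refl
interleave-odd o e (suc j) rewrite +-suc j j = interleave-odd (o ∘ suc) (e ∘ suc) j

if-true : ∀ {b} {x y : ℕ} → b ≡ true → (if b then x else y) ≡ x
if-true refl = refl

if-false : ∀ {b} {x y : ℕ} → b ≡ false → (if b then x else y) ≡ y
if-false refl = refl

rise-bound : ∀ {j K} → suc (suc (j + j)) ≤ suc K + suc K → j ≤ K
rise-bound {j} {K} h = half-≤ {j} {K} (≤-pred (≤-pred (subst (suc (suc (j + j)) ≤_) (cong suc (+-suc K K)) h)))

fall-bound : ∀ {j K} → suc (suc (suc (j + j))) ≤ suc K + suc K → j < K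
fall-bound {j} {K} h = half-< {j} {K} (≤-pred (≤-pred (subst (suc (suc (suc (j + j))) ≤_) (cong suc (+-suc K K)) h)))

-- Let q be a permutation of length k = a + s + 2 with an
-- ascent q_{a+1} < q_{a+2}; put K = a + s and n = 2K + 2.  The word w of
-- length n takes at its (j+1)-st valley and peak (positions 2j+1, 2j+2)
--   valley j = s + q_{j+1}  (j ≤ a),    j - a          (j > a),
--   peak   j = k + s + j + 1 (j < a),   s + q_{j+2}    (j ≥ a),
-- so s + q fills the positions 1,3,…,2a+1,2a+2,2a+4,…,2K+2, the small
-- values 1..s the remaining valleys and the large values k+s+1..n the
-- remaining peaks.  w is an alternating permutation containing q.
module Witness (a s : ℕ) (q : List ℕ) (lq : length q ≡ suc (suc (a + s))) (Pq : Perm q)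
               (q-ascent : at q (suc a) < at q (suc (suc a))) where

  K = a + s
  k = suc (suc K)
  n = suc K + suc K

  q' : ℕ → ℕ
  q' c = at q (suc c)

  q'-InRange : ∀ c → c < k → InRange k (q' c)
  q'-InRange c c<k = subst (λ z → InRange z (q' c)) lq (Perm.bounded Pq c (subst (c <_) (sym lq) c<k))

  q'-injective : ∀ c c' → c < k → c' < k → q' c ≡ q' c' → c ≡ c'
  q'-injective c c' c<k c'<k eq with <-cmp c c'
  ... | tri< c<c' _ _ = ⊥-elim (Perm.injective Pq c c' c<c' (subst (c' <_) (sym lq) c'<k) eq)
  ... | tri≈ _ c≡c' _ = c≡c'
  ... | tri> _ _ c'<c = ⊥-elim (Perm.injective Pq c' c c'<c (subst (c <_) (sym lq) c<k) (sym eq))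

  valley peak : ℕ → ℕ
  valley j = if j ≤ᵇ a then s + q' j else j ∸ a
  peak   j = if j <ᵇ a then k + s + suc j else s + q' (suc j)

  value : ℕ → ℕ
  value = interleave valley peak

  w : List ℕ
  w = applyUpTo value n

  valley-low : ∀ j → j ≤ a → valley j ≡ s + q' j
  valley-low j j≤a = if-true (≤ᵇ-complete j≤a)

  valley-high : ∀ j → a < j → valley j ≡ j ∸ a
  valley-high j a<j = if-false (≤ᵇ-false a<j)

  peak-low : ∀ j → j < a → peak j ≡ k + s + suc j
  peak-low j j<a = if-true (<ᵇ-complete j<a)

  peak-high : ∀ j → a ≤ j → peak j ≡ s + q' (suc j)
  peak-high j a≤j = if-false (<ᵇ-false a≤j)

  -- The three value ranges: small [1 .. s] < middle [s+1 .. s+k] < large.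
  n≡k+s+a : k + s + a ≡ n
  n≡k+s+a = solve a s
    where
    solve : ∀ a s → suc (suc (a + s)) + s + a ≡ suc (a + s) + suc (a + s)
    solve = solve-∀

  s+k≤n : s + k ≤ n
  s+k≤n = subst (_≤ n) (+-comm k s) (subst (k + s ≤_) n≡k+s+a (m≤m+n (k + s) a))

  small<middle : ∀ v m → v ≤ s → m < k → v < s + q' m
  small<middle v m v≤s m<k = ≤-<-trans v≤s (subst (_≤ s + q' m) (+-comm s 1) (+-monoʳ-≤ s (proj₁ (q'-InRange m m<k))))

  middle≤k+s : ∀ m → m < k → s + q' m ≤ k + s
  middle≤k+s m m<k = subst (s + q' m ≤_) (+-comm s k) (+-monoʳ-≤ s (proj₂ (q'-InRange m m<k)))

  middle<large : ∀ m j → m < k → s + q' m < k + s + suc j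
  middle<large m j m<k = ≤-<-trans (middle≤k+s m m<k) (m<m+n (k + s) (s≤s z≤n))

  small<large : ∀ v j → v ≤ s → v < k + s + suc j
  small<large v j v≤s = ≤-<-trans (≤-trans v≤s (m≤n+m s k)) (m<m+n (k + s) (s≤s z≤n))

  j-a≤s : ∀ {j} → j ≤ K → j ∸ a ≤ s
  j-a≤s j≤K = subst (_ ≤_) (m+n∸m≡n a s) (∸-monoˡ-≤ a j≤K)

  length-w : length w ≡ n
  length-w = length-applyUpTo value n

  at-w : ∀ p → p < n → at w (suc p) ≡ value p
  at-w = at-applyUpTo value n

  at-w-valley : ∀ j → j + j < n → at w (suc (j + j)) ≡ valley j
  at-w-valley j bound = trans (at-w (j + j) bound) (interleave-even valley peak j)

  at-w-peak : ∀ j → suc (j + j) < n → at w (suc (suc (j + j))) ≡ peak j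
  at-w-peak j bound = trans (at-w (suc (j + j)) bound) (interleave-odd valley peak j)

  valley<peak : ∀ j → j ≤ K → valley j < peak j
  valley<peak j j≤K with <-cmp j a
  ... | tri< j<a _ _ = subst₂ _<_ (sym (valley-low j (<⇒≤ j<a))) (sym (peak-low j j<a)) (middle<large j j (s≤s (m≤n⇒m≤1+n j≤K)))
  ... | tri≈ _ refl _ = subst₂ _<_ (sym (valley-low a ≤-refl)) (sym (peak-high a ≤-refl)) (+-monoʳ-< s q-ascent)
  ... | tri> _ _ a<j = subst₂ _<_ (sym (valley-high j a<j)) (sym (peak-high j (<⇒≤ a<j)))
                                   (small<middle (j ∸ a) (suc j) (j-a≤s j≤K) (s≤s (s≤s j≤K)))

  next-valley<peak : ∀ j → j < K → valley (suc j) < peak j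
  next-valley<peak j j<K with suc j ≤? a
  ... | yes j<a = subst₂ _<_ (sym (valley-low (suc j) j<a)) (sym (peak-low j j<a)) (middle<large (suc j) j (s≤s (m≤n⇒m≤1+n j<K)))
  ... | no  j≮a = subst₂ _<_ (sym (valley-high (suc j) (≰⇒> j≮a))) (sym (peak-high j (≤-pred (≰⇒> j≮a))))
                            (small<middle (suc j ∸ a) (suc j) (j-a≤s j<K) (s≤s (m≤n⇒m≤1+n j<K)))

  w-rises : OddAscents (length w) w
  w-rises j bound = subst₂ _<_ (sym (at-w-valley j (<-trans (n<1+n _) bound'))) (sym (at-w-peak j bound'))
                              (valley<peak j (rise-bound {j} {K} bound'))
    where bound' = subst (suc (suc (j + j)) ≤_) length-w bound

  w-falls : EvenDescents (length w) w
  w-falls j bound = subst₂ _<_ (sym (trans (cong (at w ∘ suc) (cong suc (sym (+-suc j j)))) (at-w-valley (suc j) next<n)))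
                              (sym (at-w-peak j (<-trans (n<1+n _) bound')))
                              (next-valley<peak j (fall-bound {j} {K} bound'))
    where
    bound' = subst (suc (suc (suc (j + j))) ≤_) length-w bound
    next<n : suc j + suc j < n
    next<n = subst (_< n) (cong suc (sym (+-suc j j))) bound'

  w-alternating : isAlternating w ≡ true
  w-alternating = alternating w w-rises w-falls

  -- w is a permutation: every position holds a small, a middle or a large
  -- value, and these determine the position.

  -- position (counted from 0) of s + q_{m+1} in w
  posQ : ℕ → ℕ
  posQ m = if m ≤ᵇ a then m + m else suc ((m ∸ 1) + (m ∸ 1))

  posQ-low : ∀ m → m ≤ a → posQ m ≡ m + m
  posQ-low m m≤a = if-true (≤ᵇ-complete m≤a)

  posQ-high : ∀ m → a ≤ m → posQ (suc m) ≡ suc (m + m)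
  posQ-high m a≤m = if-false (≤ᵇ-false (s≤s a≤m))

  value-posQ : ∀ m → value (posQ m) ≡ s + q' m
  value-posQ m with m ≤? a
  ... | yes m≤a = trans (cong value (posQ-low m m≤a)) (trans (interleave-even valley peak m) (valley-low m m≤a))
  value-posQ zero    | no 0≰a = ⊥-elim (0≰a z≤n)
  value-posQ (suc m) | no m+1≰a = trans (cong value (posQ-high m a≤m)) (trans (interleave-odd valley peak m) (peak-high m a≤m))
    where a≤m = ≤-pred (≰⇒> m+1≰a)

  data Slot : ℕ → Set where
    small  : ∀ v → 1 ≤ v → v ≤ s → Slot ((a + v) + (a + v))
    middle : ∀ m → m < k → Slot (posQ m)
    large  : ∀ j → j < a → Slot (suc (j + j))

  half-bound : ∀ {j} → j + j < n → j ≤ K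
  half-bound {j} j+j<n = ≤-pred (half-< {j} {suc K} j+j<n)

  slot : ∀ p → p < n → Slot p
  slot p p<n with parity p
  ... | even j with j ≤? a
  ...   | yes j≤a = subst Slot (posQ-low j j≤a) (middle j (s≤s (m≤n⇒m≤1+n (half-bound p<n))))
  ...   | no  j≰a = subst Slot (cong (λ z → z + z) (m+[n∸m]≡n (<⇒≤ (≰⇒> j≰a))))
                              (small (j ∸ a) (m<n⇒0<n∸m (≰⇒> j≰a)) (j-a≤s (half-bound p<n)))
  slot p p<n | odd j with suc j ≤? a
  ...   | yes j<a = large j j<a
  ...   | no  j≮a = subst Slot (posQ-high j (≤-pred (≰⇒> j≮a)))
                              (middle (suc j) (s≤s (s≤s (half-bound (<-trans (n<1+n _) p<n)))))

  slotValue : ∀ {p} → Slot p → ℕ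
  slotValue (small v _ _) = v
  slotValue (middle m _)  = s + q' m
  slotValue (large j _)   = k + s + suc j

  value-slot : ∀ {p} (σ : Slot p) → value p ≡ slotValue σ
  value-slot (small v 1≤v _) = trans (interleave-even valley peak (a + v))
                                     (trans (valley-high (a + v) (m<m+n a 1≤v)) (m+n∸m≡n a v))
  value-slot (middle m _)    = value-posQ m
  value-slot (large j j<a)   = trans (interleave-odd valley peak j) (peak-low j j<a)

  slotValue-InRange : ∀ {p} (σ : Slot p) → InRange n (slotValue σ)
  slotValue-InRange (small v 1≤v v≤s) = 1≤v , ≤-trans v≤s (≤-trans (m≤m+n s k) s+k≤n)
  slotValue-InRange (middle m m<k)    = ≤-trans (proj₁ (q'-InRange m m<k)) (m≤n+m _ s) ,
                                        ≤-trans (+-monoʳ-≤ s (proj₂ (q'-InRange m m<k))) s+k≤n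
  slotValue-InRange (large j j<a)     = s≤s z≤n , subst (k + s + suc j ≤_) n≡k+s+a (+-monoʳ-≤ (k + s) j<a)

  slot-injective : ∀ {p p'} (σ : Slot p) (σ' : Slot p') → slotValue σ ≡ slotValue σ' → p ≡ p'
  slot-injective (small v _ _)    (small v' _ _)    refl = refl
  slot-injective (small v _ v≤s)  (middle m m<k)    eq   = ⊥-elim (<⇒≢ (small<middle v m v≤s m<k) eq)
  slot-injective (small v _ v≤s)  (large j _)       eq   = ⊥-elim (<⇒≢ (small<large v j v≤s) eq)
  slot-injective (middle m m<k)   (small v _ v≤s)   eq   = ⊥-elim (<⇒≢ (small<middle v m v≤s m<k) (sym eq))
  slot-injective (middle m m<k)   (middle m' m'<k)  eq   = cong posQ (q'-injective m m' m<k m'<k (+-cancelˡ-≡ s _ _ eq))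
  slot-injective (middle m m<k)   (large j _)       eq   = ⊥-elim (<⇒≢ (middle<large m j m<k) eq)
  slot-injective (large j _)      (small v _ v≤s)   eq   = ⊥-elim (<⇒≢ (small<large v j v≤s) (sym eq))
  slot-injective (large j _)      (middle m m<k)    eq   = ⊥-elim (<⇒≢ (middle<large m j m<k) (sym eq))
  slot-injective (large j _)      (large j' _)      eq   =
    cong (λ z → suc (z + z)) (suc-injective (+-cancelˡ-≡ (k + s) _ _ eq))

  w-Perm : Perm w
  w-Perm = record { bounded = bounded ; injective = injective }
    where
    entry : ∀ c (c<n : c < n) → at w (suc c) ≡ slotValue (slot c c<n)
    entry c c<n = trans (at-w c c<n) (value-slot (slot c c<n))
    bounded : ∀ c → c < length w → InRange (length w) (at w (suc c))
    bounded c c<L = let c<n = subst (c <_) length-w c<L in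
      subst₂ InRange (sym length-w) (sym (entry c c<n)) (slotValue-InRange (slot c c<n))
    injective : ∀ c c' → c < c' → c' < length w → at w (suc c) ≢ at w (suc c')
    injective c c' c<c' c'<L eq = <⇒≢ c<c' (slot-injective (slot c c<n) (slot c' c'<n)
                                            (trans (sym (entry c c<n)) (trans eq (entry c' c'<n))))
      where
      c'<n = subst (c' <_) length-w c'<L
      c<n  = <-trans c<c' c'<n

  posQ-≤ : ∀ m → posQ m ≤ m + m
  posQ-≤ m with m ≤? a
  ... | yes m≤a = ≤-reflexive (posQ-low m m≤a)
  posQ-≤ zero    | no 0≰a   = ⊥-elim (0≰a z≤n)
  posQ-≤ (suc m) | no m+1≰a = ≤-trans (≤-reflexive (posQ-high m (≤-pred (≰⇒> m+1≰a))))
                                      (s≤s (+-monoʳ-≤ m (n≤1+n m)))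

  posQ-< : ∀ m → posQ m < posQ (suc m)
  posQ-< m with suc m ≤? a
  ... | yes m<a = subst₂ _<_ (sym (posQ-low m (<⇒≤ m<a))) (sym (posQ-low (suc m) m<a))
                              (s≤s (+-monoʳ-≤ m (n≤1+n m)))
  ... | no  m≮a = subst (posQ m <_) (sym (posQ-high m (≤-pred (≰⇒> m≮a)))) (s≤s (posQ-≤ m))

  posQ-<n : ∀ m → m < k → posQ m < n
  posQ-<n m m<k with m ≤? a
  ... | yes m≤a = subst (_< n) (sym (posQ-low m m≤a)) (≤-<-trans (+-mono-≤ m≤K m≤K) K+K<n)
    where
    m≤K = ≤-trans m≤a (m≤m+n a s)
    K+K<n : K + K < n
    K+K<n = s≤s (≤-trans (n≤1+n (K + K)) (≤-reflexive (sym (+-suc K K))))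
  posQ-<n zero    m<k | no 0≰a   = ⊥-elim (0≰a z≤n)
  posQ-<n (suc m) m<k | no m+1≰a = subst (_< n) (sym (posQ-high m (≤-pred (≰⇒> m+1≰a))))
                                         (s≤s (subst (m + m <_) (sym (+-suc K K)) (s≤s (+-mono-≤ m≤K m≤K))))
    where m≤K = ≤-pred (≤-pred m<k)

  ix : List ℕ
  ix = applyUpTo (suc ∘ posQ) k

  ix-IncSeq : IncSeq (length q) (length w) ix
  ix-IncSeq = subst₂ (λ r N → IncSeq r N ix) (sym lq) (sym length-w)
    (applyUpTo-IncSeq (suc ∘ posQ) (λ m m<k → s≤s z≤n , posQ-<n m m<k) (λ m _ → s≤s (posQ-< m)))

  w-copy : ∀ c → c < length q → at w (at ix (suc c)) ≡ s + at q (suc c)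
  w-copy c c<r = trans (cong (at w) (at-applyUpTo (suc ∘ posQ) k c c<k))
                       (trans (at-w (posQ c) (posQ-<n c c<k)) (value-posQ c))
    where c<k = subst (c <_) lq c<r

  s+k≤length-w : s + length q ≤ length w
  s+k≤length-w = subst₂ (λ r N → s + r ≤ N) (sym lq) (sym length-w) s+k≤n

A-separated : ∀ n q q' → (∀ w → w ∈ perms n → isAlternating w ≡ true → containsPattern w q' ≡ false) →
  ∀ w → w ∈ perms n → isAlternating w ≡ true → containsPattern w q ≡ true →
  length (A n q) < length (A n q')
A-separated n q q' all-avoid w w∈ alt contains =
  filter-length-< (avoids q') (avoids q) (perms n) q⇒q' w∈ (∧-true alt (cong not (all-avoid w w∈ alt))) w-fails
  where
  avoids : List ℕ → List ℕ → Bool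
  avoids r x = isAlternating x ∧ not (containsPattern x r)
  q⇒q' : ∀ x → x ∈ perms n → avoids q x ≡ true → avoids q' x ≡ true
  q⇒q' x x∈ h = ∧-true (∧-true-l h) (cong not (all-avoid x x∈ (∧-true-l h)))
  w-fails : avoids q w ≡ false
  w-fails rewrite alt | contains = refl

S-separated : ∀ 𝒴 p p' → (∀ t → isValid 𝒴 t ≡ true → containsMatrix 𝒴 t p' ≡ false) →
  ∀ t → t ∈ seqs (m 𝒴) (m 𝒴) → isTransversal 𝒴 t ≡ true → isValid 𝒴 t ≡ true → containsMatrix 𝒴 t p ≡ true →
  length (S 𝒴 p) < length (S 𝒴 p')
S-separated 𝒴 p p' all-avoid t t∈ transversal valid contains =
  filter-length-< (avoids p') (avoids p) (seqs (m 𝒴) (m 𝒴)) p⇒p' t∈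
    (∧-true transversal (∧-true valid (cong not (all-avoid t valid)))) t-fails
  where
  avoids : List ℕ → List ℕ → Bool
  avoids r x = isTransversal 𝒴 x ∧ isValid 𝒴 x ∧ not (containsMatrix 𝒴 x r)
  p⇒p' : ∀ x → x ∈ seqs (m 𝒴) (m 𝒴) → avoids p x ≡ true → avoids p' x ≡ true
  p⇒p' x _ h = let valid-x = ∧-true-l (∧-true-r {isTransversal 𝒴 x} h) in
    ∧-true (∧-true-l {isTransversal 𝒴 x} h) (∧-true valid-x (cong not (all-avoid x valid-x)))
  t-fails : avoids p t ≡ false
  t-fails rewrite transversal | valid | contains = refl

ShapeEquiv-sym : ∀ p p' → ShapeEquiv2Alt p p' → ShapeEquiv2Alt p' p
ShapeEquiv-sym p p' SE 𝒴 two-alt = sym (SE 𝒴 two-alt)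

different-sizes-not-equivalent : ∀ p p' → 1 ≤ length p → Perm p → length p < length p' → ¬ ShapeEquiv2Alt p p'
different-sizes-not-equivalent p p' r≥1 P shorter SE = <⇒≢ fewer (SE 𝒴 (plain-2alt r r≥1))
  where
  r = length p
  𝒴 = Plain.diagram r r≥1
  range-IncSeq : IncSeq r r (range r)
  range-IncSeq = applyUpTo-IncSeq suc (λ c c<r → s≤s z≤n , c<r) (λ c _ → ≤-refl)
  fewer : length (S 𝒴 p) < length (S 𝒴 p')
  fewer = S-separated 𝒴 p p' (λ t _ → too-large-avoided 𝒴 t p' shorter) p (Perm⇒seqs p P)
    (Plain.Perm⇒transversal r r≥1 p refl P) (plain-valid r r≥1 p)
    (Plain.shifted-copy⇒containsMatrix r r≥1 p p 0 (range r) r≥1 P range-IncSeq ≤-refl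
       (λ c c<r → cong (at p) (at-range r c c<r)))

alternating-avoids-decPerm : ∀ K w → w ∈ perms (suc K + suc K) → isAlternating w ≡ true →
  containsPattern w (decPerm (suc (suc K))) ≡ false
alternating-avoids-decPerm K w w∈ alt =
  odd-ascents-avoid-pattern K w (decPerm (suc (suc K))) lw
    (subst (λ L → OddAscents L w) lw (isAlternating⇒OddAscents w alt))
    (length-decPerm (suc (suc K))) (decPerm-Descending (suc (suc K)))
  where lw = proj₁ (seqs⁻ (suc K + suc K) (suc K + suc K) w (proj₁ (filter⁻ isPerm {seqs (suc K + suc K) (suc K + suc K)} w∈)))

alternating-valid-avoids-J : ∀ K n≥1 t → isValid (Alternating.diagram (suc K + suc K) n≥1) t ≡ true →
  containsMatrix (Alternating.diagram (suc K + suc K) n≥1) t (J (suc (suc K))) ≡ false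
alternating-valid-avoids-J K n≥1 t valid-t =
  odd-ascents-avoid-matrix K (Alternating.diagram (suc K + suc K) n≥1) t (J (suc (suc K))) refl
    (valid⇒OddAscents _ n≥1 t valid-t) (length-decPerm (suc (suc K)))
    (decPerm-Perm (suc (suc K))) (decPerm-Descending (suc (suc K)))

A-count-differs : ∀ a s q → (lq : length q ≡ suc (suc (a + s))) → Perm q → at q (suc a) < at q (suc (suc a)) →
  length (A (suc (a + s) + suc (a + s)) (decPerm (suc (suc (a + s))))) ≢ length (A (suc (a + s) + suc (a + s)) q)
A-count-differs a s q lq P q-ascent eq = <⇒≢ fewer (sym eq)
  where
  open Witness a s q lq P q-ascent
  w∈perms : w ∈ perms n
  w∈perms = filter⁺ isPerm (subst (λ L → w ∈ seqs L L) length-w (Perm⇒seqs w w-Perm)) (Perm⇒isPerm w w-Perm)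
  fewer : length (A n q) < length (A n (decPerm k))
  fewer = A-separated n q (decPerm k) (alternating-avoids-decPerm K) w w∈perms w-alternating
    (shifted-copy⇒containsPattern w q s ix ix-IncSeq w-copy)

S-count-differs : ∀ a s p → (lp : length p ≡ suc (suc (a + s))) → Perm p → at p (suc a) < at p (suc (suc a)) →
  ¬ ShapeEquiv2Alt (J (suc (suc (a + s)))) p
S-count-differs a s p lp P p-ascent SE = <⇒≢ fewer (sym (SE 𝒴 (alternating-2alt n n≥1)))
  where
  open Witness a s p lp P p-ascent
  n≥1 : 1 ≤ n
  n≥1 = s≤s z≤n
  𝒴 = Alternating.diagram n n≥1
  rises : OddAscents n w
  rises = subst (λ L → OddAscents L w) length-w w-rises
  falls : EvenDescents n w
  falls = subst (λ L → EvenDescents L w) length-w w-falls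
  fewer : length (S 𝒴 p) < length (S 𝒴 (J k))
  fewer = S-separated 𝒴 p (J k) (alternating-valid-avoids-J K n≥1) w
    (subst (λ L → w ∈ seqs L L) length-w (Perm⇒seqs w w-Perm))
    (Alternating.Perm⇒transversal n n≥1 w length-w w-Perm) (valid n n≥1 w rises falls)
    (Alternating.shifted-copy⇒containsMatrix n n≥1 w p s ix (subst (1 ≤_) (sym lp) (s≤s z≤n)) P
       (subst (λ L → IncSeq (length p) L ix) length-w ix-IncSeq)
       (subst (s + length p ≤_) length-w s+k≤length-w) w-copy)

ascent-split : ∀ k q → length q ≡ k → Perm q → q ≢ decPerm k →
  ∃[ a ] ∃[ s ] (k ≡ suc (suc (a + s)) × at q (suc a) < at q (suc (suc a)))
ascent-split k q lq P q≢δ with ascent k q lq P q≢δ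
... | a , a+1<k , up = a , k ∸ suc (suc a) , sym (m+[n∸m]≡n a+1<k) , up

double-even : ∀ m → 2 ∣ m + m
double-even m = divides m (double m)
  where
  double : ∀ m → m + m ≡ m * 2
  double = solve-∀

decPerm-separated : ∀ k q → length q ≡ k → Perm q → q ≢ decPerm k →
  ∃[ n ] (2 ∣ n × length (A n (decPerm k)) ≢ length (A n q))
decPerm-separated k q lq P q≢δ with ascent-split k q lq P q≢δ
... | a , s , refl , q-ascent = suc (a + s) + suc (a + s) , double-even (suc (a + s)) , A-count-differs a s q lq P q-ascent

J-equal-size-isolated : ∀ k p → length p ≡ k → Perm p → p ≢ J k → ¬ ShapeEquiv2Alt (J k) p
J-equal-size-isolated k p lp P p≢J with ascent-split k p lp P p≢J
... | a , s , refl , p-ascent = S-count-differs a s p lp P p-ascent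

J-isolated : ∀ k p → 1 ≤ k → 1 ≤ length p → Perm p → p ≢ J k → ¬ ShapeEquiv2Alt (J k) p
J-isolated k p k≥1 p≥1 P p≢J with <-cmp (length p) k
... | tri< shorter _ _ = different-sizes-not-equivalent p (J k) p≥1 P (subst (length p <_) (sym (length-decPerm k)) shorter)
                        ∘ ShapeEquiv-sym (J k) p
... | tri≈ _ same _   = J-equal-size-isolated k p same P p≢J
... | tri> _ _ longer  = different-sizes-not-equivalent (J k) p (subst (1 ≤_) (sym (length-decPerm k)) k≥1)
                          (decPerm-Perm k) (subst (_< length p) (sym (length-decPerm k)) longer)

corollary5p6 : (k : ℕ) → 1 ≤ k →
    ((q : List ℕ) → length q ≡ k → isPerm q ≡ true → q ≢ decPerm k →
      ∃[ n ] (2 ∣ n × length (A n (decPerm k)) ≢ length (A n q)))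
    ×
    ((p : List ℕ) → 1 ≤ length p → isPerm p ≡ true → p ≢ J k →
      ¬ ShapeEquiv2Alt (J k) p)
corollary5p6 k k≥1 =
  (λ q lq q-perm q≢δ → decPerm-separated k q lq (isPerm⇒Perm q q-perm) q≢δ) ,
  (λ p p≥1 p-perm p≢J → J-isolated k p k≥1 p≥1 (isPerm⇒Perm p p-perm) p≢J)
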